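{- Let $\mathcal{K}$ be a finite oriented $d$-dimensional simplicial complex, $\gamma$ a null-homologous $(d-1)$-cycle, and $C \subseteq \mathcal{K}^d$ a combinatorial $\gamma$-cut that is minimal in the sense that for every proper subset $C' \subset C$ we have $\dim H_{d-1}(\mathcal{K}\setminus C') < \dim H_{d-1}(\mathcal{K}\setminus C)$. Then there exists a $(d-1)$-cochain $p$ such that $\mathsf{supp}(\delta(p)) = C$.
   Context: $\mathcal{K}$ is a finite abstract simplicial complex of dimension $d$ whose simplices are oriented by a fixed linear order on the vertices; $\mathcal{K}^k$ is the set of $k$-simplices. Chains $C_k(\mathcal{K})$ and cochains $C^k(\mathcal{K})$ have real coefficients; $\partial$ is the simplicial boundary and $\delta p = p\circ\partial$ the coboundary; homology $H_{d-1}$ is taken with real coefficients. A $(d-1)$-cycle $\gamma$ is null-homologous if $\gamma=\partial\Gamma$ for some $d$-chain $\Gamma$. For a set $C$ of $d$-simplices, $\mathcal{K}\setminus C$ is the subcomplex obtained by deleting the $d$-simplices of $C$. A combinatorial $\gamma$-cut is a set $C\subseteq\mathcal{K}^d$ such that $\gamma$ is not null-homologous in $\mathcal{K}\setminus C$. The support of a (co)chain $\sum\alpha_i\sigma_i$ is $\{\sigma_i:\alpha_i\neq0\}$.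
   Formalization: Chains, cochains and homology are taken over ℚ instead of ℝ, so the cycle γ has rational coefficients and the cochain p is sought among rational cochains. -}

module Defs where

open import Data.Nat as ℕ using (ℕ; zero; suc; _≤_; _<_)
open import Data.Fin as Fin using (Fin; zero; suc)
open import Data.Fin.Properties as FinP using ()
open import Data.List using (List; []; _∷_; length; removeAt; filter; foldr; map; allFin)
open import Data.List.Properties using (≡-dec)
open import Data.List.Relation.Unary.All using (All)
open import Data.List.Relation.Unary.Any using (Any)
open import Data.List.Relation.Unary.Linked using (Linked)
open import Data.List.Relation.Unary.Unique.Propositional using (Unique)
open import Data.List.Membership.Propositional using (_∈_; _∉_)
import Data.List.Membership.DecPropositional as DecMem
open import Data.Rational using (ℚ; 0ℚ; 1ℚ; _+_; _*_; -_; _-_)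
open import Data.Product using (Σ; _×_; ∃)
open import Relation.Binary.PropositionalEquality using (_≡_; _≢_)
open import Relation.Nullary using (¬_; yes; no; ¬?)

open import Relation.Binary using (DecidableEquality)

-- Simplices on vertex set Fin n are strictly increasing lists of vertices
-- (orientation induced by the linear order of Fin n).
-- A k-simplex is a list of length k+1.
Simplex : ℕ → Set
Simplex n = List (Fin n)

_≟ₛ_ : ∀ {n} → DecidableEquality (Simplex n)
_≟ₛ_ = ≡-dec Fin._≟_

record Complex (n : ℕ) : Set where
  field
    simplices : List (Simplex n)
    unique    : Unique simplices
    nonempty  : All (λ σ → σ ≢ []) simplices
    sorted    : All (Linked Fin._<_) simplices
    closed    : ∀ σ → σ ∈ simplices → 2 ≤ length σ →
                (i : Fin (length σ)) → removeAt σ i ∈ simplices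
open Complex public

HasDimension : ∀ {n} → Complex n → ℕ → Set
HasDimension K d =
  All (λ σ → length σ ≤ suc d) (simplices K) × Any (λ σ → length σ ≡ suc d) (simplices K)

-- (Co)chains with rational coefficients: functions on simplices; only the
-- values on simplices of the relevant dimension in the complex matter.
Chain : ℕ → Set
Chain n = Simplex n → ℚ

sgn : ℕ → ℚ
sgn zero = 1ℚ
sgn (suc k) = - sgn k

sumℚ : List ℚ → ℚ
sumℚ = foldr _+_ 0ℚ

[_≟_]ℚ : ∀ {n} → Simplex n → Simplex n → ℚ
[ σ ≟ τ ]ℚ with σ ≟ₛ τ
... | yes _ = 1ℚ
... | no  _ = 0ℚ

incidence : ∀ {n} → Simplex n → Simplex n → ℚ
incidence σ τ = sumℚ (map (λ i → sgn (Fin.toℕ i) * [ removeAt σ i ≟ τ ]ℚ) (allFin (length σ)))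

ofLength : ∀ {n} → ℕ → List (Simplex n) → List (Simplex n)
ofLength m = filter (λ σ → length σ ℕ.≟ m)

∂[_,_] : ∀ {n} → List (Simplex n) → ℕ → Chain n → Chain n
∂[ L , m ] c τ = sumℚ (map (λ σ → incidence σ τ * c σ) (ofLength m L))

δ : ∀ {n} → Chain n → Chain n
δ p σ = sumℚ (map (λ i → sgn (Fin.toℕ i) * p (removeAt σ i)) (allFin (length σ)))

_≈[_,_]_ : ∀ {n} → Chain n → List (Simplex n) → ℕ → Chain n → Set
c ≈[ L , m ] c' = ∀ τ → τ ∈ L → length τ ≡ m → c τ ≡ c' τ

zeroC : ∀ {n} → Chain n
zeroC _ = 0ℚ

-- Throughout, k is the number of vertices of the simplices carrying the chain,
-- so a (d-1)-chain is carried by simplices with d vertices.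

IsCycle : ∀ {n} → List (Simplex n) → ℕ → Chain n → Set
IsCycle L k z = ∀ τ → τ ∈ L → suc (length τ) ≡ k → ∂[ L , k ] z τ ≡ 0ℚ

IsBoundary : ∀ {n} → List (Simplex n) → ℕ → Chain n → Set
IsBoundary {n} L k z = Σ (Chain n) λ Γ → ∂[ L , suc k ] Γ ≈[ L , k ] z

lincomb : ∀ {n r} → (Fin r → ℚ) → (Fin r → Chain n) → Chain n
lincomb {r = r} a z τ = sumℚ (map (λ i → a i * z i τ) (allFin r))

HomologyDim : ∀ {n} → List (Simplex n) → ℕ → ℕ → Set
HomologyDim {n} L k r =
  Σ (Fin r → Chain n) λ z →
    (∀ i → IsCycle L k (z i)) ×
    (∀ (a : Fin r → ℚ) → IsBoundary L k (lincomb a z) → ∀ i → a i ≡ 0ℚ) ×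
    (∀ y → IsCycle L k y → Σ (Fin r → ℚ) λ a → IsBoundary L k (λ τ → y τ - lincomb a z τ))

_∖_ : ∀ {n} → Complex n → List (Simplex n) → List (Simplex n)
K ∖ C = filter (λ σ → ¬? (σ ∈? C)) (simplices K)
  where open DecMem _≟ₛ_

-- sets of simplices as lists (up to membership)
_⊆ˢ_ : ∀ {n} → List (Simplex n) → List (Simplex n) → Set
A ⊆ˢ B = ∀ σ → σ ∈ A → σ ∈ B

_⊂ˢ_ : ∀ {n} → List (Simplex n) → List (Simplex n) → Set
A ⊂ˢ B = A ⊆ˢ B × ∃ λ σ → σ ∈ B × σ ∉ A

IsCut : ∀ {n} → Complex n → ℕ → Chain n → List (Simplex n) → Set
IsCut K d γ C = C ⊆ˢ ofLength (suc d) (simplices K) × ¬ IsBoundary (K ∖ C) d γ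

-- Work in ℚ^T, T the (d−1)-simplices of K, with the standard inner product, and let B be spanned
-- by the boundaries ∂σ of the d-simplices of K ∖ C. If ∂σ ∈ B for some σ ∈ C, then K ∖ (C − σ)
-- has the same (d−1)-cycles and boundaries as K ∖ C, hence the same H_{d−1}, contradicting
-- minimality. So every ∂σ, σ ∈ C, has a non-zero residual modulo B, and a generic combination p
-- of these residuals is orthogonal to B yet pairs non-trivially with each such ∂σ. Since
-- δp(σ) = ⟨∂σ, p⟩, the support of δp is exactly C. Gram–Schmidt over ℚ provides the projections
-- and a basis of H_{d−1}.

module Submission where

open import Defs
open import Algebra.Apartness.Properties.HeytingCommutativeRing as Apartness using ()
open import Data.Empty using (⊥-elim)
open import Data.Fin as Fin using (Fin; zero; suc)
open import Data.List using (List; []; _∷_; _++_; length; map; filter; allFin; lookup; tabulate; removeAt)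
open import Data.List.Properties using (filter-accept; filter-reject; map-tabulate; map-cong)
import Data.List.Extrema
open import Data.List.Membership.Propositional using (_∈_; _∉_)
open import Data.List.Membership.Propositional.Properties
  using (∈-++⁺ˡ; ∈-++⁺ʳ; ∈-++⁻; ∈-map⁺; ∈-map⁻; ∈-filter⁺; ∈-filter⁻; ∈-lookup)
import Data.List.Membership.DecPropositional as DecMembership
open import Data.List.Relation.Unary.All as All using (All; []; _∷_)
open import Data.List.Relation.Unary.AllPairs using (_∷_)
open import Data.List.Relation.Unary.Any using (here; there)
open import Data.List.Relation.Unary.Unique.Propositional using (Unique)
import Data.List.Relation.Unary.Unique.Propositional.Properties as Unique
open import Data.Nat as ℕ using (ℕ; suc; _<_)
import Data.Nat.Properties as ℕ
open import Data.Product using (Σ; ∃; _×_; _,_; proj₁; proj₂)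
open import Data.Rational as ℚ
  using (ℚ; 0ℚ; 1ℚ; _+_; _*_; -_; _-_; _≤_; _≥_; 1/_; ≢-nonZero; nonNegative; nonPositive)
open import Data.Rational.Properties
open import Data.Rational.Solver using (module +-*-Solver)
open import Data.Sum using (_⊎_; inj₁; inj₂)
open import Function using (_∘_)
open import Function.Bundles using (_⇔_; mk⇔; module Equivalence)
open import Function.Construct.Composition using (_⇔-∘_)
open import Function.Construct.Symmetry using (⇔-sym)
open import Relation.Binary.Bundles using (DecTotalOrder)
open import Relation.Binary.PropositionalEquality
open import Relation.Nullary using (¬_; Dec; yes; no; ¬?)
open import Relation.Nullary.Decidable using (decidable-stable)

open +-*-Solver
open Apartness heytingCommutativeRing using (x#0y#0→xy#0)

x*x≥0 : ∀ x → x * x ≥ 0ℚ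
x*x≥0 x with ≤-total 0ℚ x
... | inj₁ 0≤x = nonNegative⁻¹ _ {{nonNeg*nonNeg⇒nonNeg x {{nonNegative 0≤x}} x {{nonNegative 0≤x}}}}
... | inj₂ x≤0 = nonNegative⁻¹ _ {{nonPos*nonPos⇒nonPos x {{nonPositive x≤0}} x {{nonPositive x≤0}}}}

x*y≡0⇒x≡0 : ∀ x {y} → x * y ≡ 0ℚ → y ≢ 0ℚ → x ≡ 0ℚ
x*y≡0⇒x≡0 x xy≡0 y≢0 = decidable-stable (x ≟ 0ℚ) (λ x≢0 → x#0y#0→xy#0 x≢0 y≢0 xy≡0)

x*x≡0⇒x≡0 : ∀ x → x * x ≡ 0ℚ → x ≡ 0ℚ
x*x≡0⇒x≡0 x xx≡0 = decidable-stable (x ≟ 0ℚ) (λ x≢0 → x#0y#0→xy#0 x≢0 x≢0 xx≡0)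

x+y≡0⇒x≡0∧y≡0 : ∀ {x y} → x ≥ 0ℚ → y ≥ 0ℚ → x + y ≡ 0ℚ → x ≡ 0ℚ × y ≡ 0ℚ
x+y≡0⇒x≡0∧y≡0 {x} {y} x≥0 y≥0 x+y≡0 = x≡0 , y≡0
  where
  x≡0 : x ≡ 0ℚ
  x≡0 = ≤-antisym (subst₂ _≤_ (+-identityʳ x) x+y≡0 (+-monoʳ-≤ x y≥0)) x≥0
  y≡0 : y ≡ 0ℚ
  y≡0 = trans (sym (+-identityˡ y)) (trans (cong (_+ y) (sym x≡0)) x+y≡0)

-- A total reciprocal; its junk value at 0 is never used.
recip : ℚ → ℚ
recip x with x ≟ 0ℚ
... | yes _   = 0ℚ
... | no x≢0 = 1/_ x {{≢-nonZero x≢0}}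

x*recip[x]≡1 : ∀ x → x ≢ 0ℚ → x * recip x ≡ 1ℚ
x*recip[x]≡1 x x≢0 with x ≟ 0ℚ
... | yes x≡0  = ⊥-elim (x≢0 x≡0)
... | no x≢0′ = *-inverseʳ x {{≢-nonZero x≢0′}}

t*b+a≡0⇒t≡-a/b : ∀ t a b → t * b + a ≡ 0ℚ → b ≢ 0ℚ → t ≡ - a * recip b
t*b+a≡0⇒t≡-a/b t a b t*b+a≡0 b≢0 = begin
  t                                    ≡⟨ sym (*-identityʳ t) ⟩
  t * 1ℚ                               ≡⟨ cong (t *_) (sym (x*recip[x]≡1 b b≢0)) ⟩
  t * (b * recip b)                    ≡⟨ solve 4 (λ t a b i → t :* (b :* i) := (t :* b :+ a) :* i :+ (:- a) :* i)
                                                 refl t a b (recip b) ⟩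
  (t * b + a) * recip b + - a * recip b ≡⟨ cong (λ s → s * recip b + - a * recip b) t*b+a≡0 ⟩
  0ℚ * recip b + - a * recip b          ≡⟨ solve 2 (λ i s → con 0ℚ :* i :+ s := s) refl (recip b) (- a * recip b) ⟩
  - a * recip b                         ∎
  where open ≡-Reasoning

∃-∉ : (xs : List ℚ) → ∃ λ t → t ∉ xs
∃-∉ xs = m + 1ℚ , λ m+1∈xs → <-irrefl refl (≤-<-trans (All.lookup (xs≤max 0ℚ xs) m+1∈xs) m<m+1)
  where
  open Data.List.Extrema (DecTotalOrder.totalOrder ≤-decTotalOrder) using (max; xs≤max)
  m = max 0ℚ xs
  m<m+1 : m ℚ.< m + 1ℚ
  m<m+1 = <-respˡ-≡ (+-identityʳ m) (+-monoʳ-< m (positive⁻¹ 1ℚ))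

avoid-roots : {S : Set} (J : List S) (α β : S → ℚ) → (∀ j → j ∈ J → β j ≢ 0ℚ ⊎ α j ≢ 0ℚ) →
              ∃ λ t → ∀ j → j ∈ J → t * β j + α j ≢ 0ℚ
avoid-roots J α β nondegenerate = t , nonRoot
  where
  root = λ j → - α j * recip (β j)
  t = proj₁ (∃-∉ (map root J))
  nonRoot : ∀ j → j ∈ J → t * β j + α j ≢ 0ℚ
  nonRoot j j∈J t*β+α≡0 with β j ≟ 0ℚ | nondegenerate j j∈J
  ... | yes β≡0 | inj₁ β≢0 = β≢0 β≡0
  ... | yes β≡0 | inj₂ α≢0 =
    α≢0 (trans (sym (solve 2 (λ t a → t :* con 0ℚ :+ a := a) refl t (α j)))
               (trans (cong (λ b → t * b + α j) (sym β≡0)) t*β+α≡0))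
  ... | no β≢0 | _ =
    proj₂ (∃-∉ (map root J)) (subst (_∈ map root J) (sym (t*b+a≡0⇒t≡-a/b t (α j) (β j) t*β+α≡0 β≢0)) (∈-map⁺ root j∈J))

module _ {X : Set} where

  dot : List X → (X → ℚ) → (X → ℚ) → ℚ
  dot J u v = sumℚ (map (λ x → u x * v x) J)

  dot-comm : ∀ J u v → dot J u v ≡ dot J v u
  dot-comm []      u v = refl
  dot-comm (x ∷ J) u v = cong₂ _+_ (*-comm (u x) (v x)) (dot-comm J u v)

  dot-+ˡ : ∀ J u v w → dot J (λ x → u x + v x) w ≡ dot J u w + dot J v w
  dot-+ˡ []      u v w = refl
  dot-+ˡ (x ∷ J) u v w rewrite dot-+ˡ J u v w =
    solve 5 (λ u v w U V → (u :+ v) :* w :+ (U :+ V) := (u :* w :+ U) :+ (v :* w :+ V))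
      refl (u x) (v x) (w x) (dot J u w) (dot J v w)

  dot-*ˡ : ∀ J a u w → dot J (λ x → a * u x) w ≡ a * dot J u w
  dot-*ˡ []      a u w = solve 1 (λ a → con 0ℚ := a :* con 0ℚ) refl a
  dot-*ˡ (x ∷ J) a u w rewrite dot-*ˡ J a u w =
    solve 4 (λ a u w U → a :* u :* w :+ a :* U := a :* (u :* w :+ U)) refl a (u x) (w x) (dot J u w)

  dot-linearˡ : ∀ J a u v w → dot J (λ x → a * u x + v x) w ≡ a * dot J u w + dot J v w
  dot-linearˡ J a u v w = trans (dot-+ˡ J (λ x → a * u x) v w) (cong (_+ dot J v w) (dot-*ˡ J a u w))

  dot-subˡ : ∀ J u v w → dot J (λ x → u x - v x) w ≡ dot J u w - dot J v w
  dot-subˡ []      u v w = refl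
  dot-subˡ (x ∷ J) u v w rewrite dot-subˡ J u v w =
    solve 5 (λ u v w U V → (u :- v) :* w :+ (U :- V) := (u :* w :+ U) :- (v :* w :+ V))
      refl (u x) (v x) (w x) (dot J u w) (dot J v w)

  dot-congˡ : ∀ J {u u′} w → (∀ x → x ∈ J → u x ≡ u′ x) → dot J u w ≡ dot J u′ w
  dot-congˡ []      w u≡u′ = refl
  dot-congˡ (x ∷ J) w u≡u′ = cong₂ _+_ (cong (_* w x) (u≡u′ x (here refl))) (dot-congˡ J w (λ y y∈ → u≡u′ y (there y∈)))

  dot-zeroˡ : ∀ J {u} w → (∀ x → x ∈ J → u x ≡ 0ℚ) → dot J u w ≡ 0ℚ
  dot-zeroˡ []      w u≡0 = refl
  dot-zeroˡ (x ∷ J) w u≡0 rewrite u≡0 x (here refl) | dot-zeroˡ J w (λ y y∈ → u≡0 y (there y∈)) =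
    solve 1 (λ w → con 0ℚ :* w :+ con 0ℚ := con 0ℚ) refl (w x)

  dot-zeroʳ : ∀ J u {w} → (∀ x → x ∈ J → w x ≡ 0ℚ) → dot J u w ≡ 0ℚ
  dot-zeroʳ J u {w} w≡0 = trans (dot-comm J u w) (dot-zeroˡ J u w≡0)

  dot-sumˡ : ∀ {I : Set} J (is : List I) (g : I → X → ℚ) w →
             dot J (λ x → sumℚ (map (λ i → g i x) is)) w ≡ sumℚ (map (λ i → dot J (g i) w) is)
  dot-sumˡ J []       g w = dot-zeroˡ J w (λ _ _ → refl)
  dot-sumˡ J (i ∷ is) g w =
    trans (dot-+ˡ J (g i) (λ x → sumℚ (map (λ i → g i x) is)) w) (cong (dot J (g i) w +_) (dot-sumˡ J is g w))

  dot-self≥0 : ∀ J u → dot J u u ≥ 0ℚ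
  dot-self≥0 []      u = ≤-refl
  dot-self≥0 (x ∷ J) u = subst (_≤ u x * u x + dot J u u) (+-identityʳ 0ℚ) (+-mono-≤ (x*x≥0 (u x)) (dot-self≥0 J u))

  dot-self≡0⇒≡0 : ∀ J u → dot J u u ≡ 0ℚ → ∀ x → x ∈ J → u x ≡ 0ℚ
  dot-self≡0⇒≡0 (y ∷ J) u uu≡0 x (here refl) =
    x*x≡0⇒x≡0 (u x) (proj₁ (x+y≡0⇒x≡0∧y≡0 (x*x≥0 (u x)) (dot-self≥0 J u) uu≡0))
  dot-self≡0⇒≡0 (y ∷ J) u uu≡0 x (there x∈J) =
    dot-self≡0⇒≡0 J u (proj₂ (x+y≡0⇒x≡0∧y≡0 (x*x≥0 (u y)) (dot-self≥0 J u) uu≡0)) x x∈J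

module _ {X : Set} where

  combination : (zs : List (X → ℚ)) → (Fin (length zs) → ℚ) → X → ℚ
  combination []       a x = 0ℚ
  combination (z ∷ zs) a x = a zero * z x + combination zs (a ∘ suc) x

  combination-zero : ∀ zs x → combination zs (λ _ → 0ℚ) x ≡ 0ℚ
  combination-zero []       x = refl
  combination-zero (z ∷ zs) x rewrite combination-zero zs x = solve 1 (λ z → con 0ℚ :* z :+ con 0ℚ := con 0ℚ) refl (z x)

  combination-+ : ∀ zs a b x → combination zs (λ i → a i + b i) x ≡ combination zs a x + combination zs b x
  combination-+ []       a b x = refl
  combination-+ (z ∷ zs) a b x rewrite combination-+ zs (a ∘ suc) (b ∘ suc) x =
    solve 5 (λ a b z p q → (a :+ b) :* z :+ (p :+ q) := (a :* z :+ p) :+ (b :* z :+ q))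
      refl (a zero) (b zero) (z x) (combination zs (a ∘ suc) x) (combination zs (b ∘ suc) x)

  combination-* : ∀ zs a c x → combination zs (λ i → c * a i) x ≡ c * combination zs a x
  combination-* []       a c x = solve 1 (λ c → con 0ℚ := c :* con 0ℚ) refl c
  combination-* (z ∷ zs) a c x rewrite combination-* zs (a ∘ suc) c x =
    solve 4 (λ c a z p → c :* a :* z :+ c :* p := c :* (a :* z :+ p)) refl c (a zero) (z x) (combination zs (a ∘ suc) x)

  combination-∈ : ∀ {g} zs → g ∈ zs → ∃ λ a → ∀ x → combination zs a x ≡ g x
  combination-∈ {g} (z ∷ zs) (here refl) = a , λ x →
    trans (cong (1ℚ * g x +_) (combination-zero zs x)) (solve 1 (λ g → con 1ℚ :* g :+ con 0ℚ := g) refl (g x))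
    where
    a : Fin (suc (length zs)) → ℚ
    a zero    = 1ℚ
    a (suc i) = 0ℚ
  combination-∈ {g} (z ∷ zs) (there g∈zs) with combination-∈ zs g∈zs
  ... | a′ , a′↦g = a , λ x →
    trans (cong (0ℚ * z x +_) (a′↦g x)) (solve 2 (λ z g → con 0ℚ :* z :+ g := g) refl (z x) (g x))
    where
    a : Fin (suc (length zs)) → ℚ
    a zero    = 0ℚ
    a (suc i) = a′ i

  weightedSum : {Y : Set} → List Y → (Y → X → ℚ) → (Y → ℚ) → X → ℚ
  weightedSum J f a x = sumℚ (map (λ j → f j x * a j) J)

  weightedSum-- : ∀ {Y : Set} (J : List Y) f g a x →
                  weightedSum J (λ j x → f j x - g j x) a x ≡ weightedSum J f a x - weightedSum J g a x
  weightedSum-- J f g a x = dot-subˡ J (λ j → f j x) (λ j → g j x) a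

module Coordinates {X : Set} (T : List X) where

  Vector : Set
  Vector = X → ℚ

  infix 4 _≈_
  _≈_ : Vector → Vector → Set
  u ≈ v = ∀ x → x ∈ T → u x ≡ v x

  0ᵛ : Vector
  0ᵛ _ = 0ℚ

  ⟨_,_⟩ : Vector → Vector → ℚ
  ⟨_,_⟩ = dot T

  infix 4 _⊥_
  _⊥_ : List Vector → Vector → Set
  gs ⊥ w = ∀ g → g ∈ gs → ⟨ g , w ⟩ ≡ 0ℚ

  data Span (gs : List Vector) : Vector → Set where
    span-zero : ∀ {v} → v ≈ 0ᵛ → Span gs v
    span-add  : ∀ {g u v} → g ∈ gs → (a : ℚ) → Span gs u → v ≈ (λ x → a * g x + u x) → Span gs v

  Span-resp-≈ : ∀ {gs u v} → Span gs u → u ≈ v → Span gs v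
  Span-resp-≈ (span-zero u≈0)         u≈v = span-zero (λ x x∈ → trans (sym (u≈v x x∈)) (u≈0 x x∈))
  Span-resp-≈ (span-add g∈ a s u≈ag+w) u≈v = span-add g∈ a s (λ x x∈ → trans (sym (u≈v x x∈)) (u≈ag+w x x∈))

  Span-∈ : ∀ {gs g} → g ∈ gs → Span gs g
  Span-∈ {g = g} g∈ = span-add g∈ 1ℚ (span-zero (λ _ _ → refl)) (λ x _ → solve 1 (λ g → g := con 1ℚ :* g :+ con 0ℚ) refl (g x))

  Span-+ : ∀ {gs u v} → Span gs u → Span gs v → Span gs (λ x → u x + v x)
  Span-+ {v = v} (span-zero u≈0) sv = Span-resp-≈ sv (λ x x∈ → trans (sym (+-identityˡ (v x))) (cong (_+ v x) (sym (u≈0 x x∈))))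
  Span-+ {v = v} (span-add {g} {w} g∈ a sw u≈ag+w) sv =
    span-add g∈ a (Span-+ sw sv) (λ x x∈ → trans (cong (_+ v x) (u≈ag+w x x∈)) (+-assoc (a * g x) (w x) (v x)))

  Span-* : ∀ {gs u} c → Span gs u → Span gs (λ x → c * u x)
  Span-* c (span-zero u≈0) = span-zero (λ x x∈ → trans (cong (c *_) (u≈0 x x∈)) (*-zeroʳ c))
  Span-* c (span-add {g} {w} g∈ a sw u≈ag+w) = span-add g∈ (c * a) (Span-* c sw) (λ x x∈ →
    trans (cong (c *_) (u≈ag+w x x∈)) (solve 4 (λ c a g w → c :* (a :* g :+ w) := c :* a :* g :+ c :* w) refl c a (g x) (w x)))

  Span-- : ∀ {gs u v} → Span gs u → Span gs v → Span gs (λ x → u x - v x)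
  Span-- {u = u} {v} su sv = Span-resp-≈ (Span-+ su (Span-* (- 1ℚ) sv))
    (λ x _ → solve 2 (λ u v → u :+ (:- con 1ℚ) :* v := u :- v) refl (u x) (v x))

  Span-trans : ∀ {gs hs v} → (∀ g → g ∈ gs → Span hs g) → Span gs v → Span hs v
  Span-trans gs⊆⟨hs⟩ (span-zero v≈0)            = span-zero v≈0
  Span-trans gs⊆⟨hs⟩ (span-add {g} g∈ a su v≈) =
    Span-resp-≈ (Span-+ (Span-* a (gs⊆⟨hs⟩ g g∈)) (Span-trans gs⊆⟨hs⟩ su)) (λ x x∈ → sym (v≈ x x∈))

  Span-mono : ∀ {gs hs v} → (∀ g → g ∈ gs → g ∈ hs) → Span gs v → Span hs v
  Span-mono gs⊆hs = Span-trans (λ g g∈ → Span-∈ (gs⊆hs g g∈))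

  ⟨Span,_⟩≡0 : ∀ w {gs v} → gs ⊥ w → Span gs v → ⟨ v , w ⟩ ≡ 0ℚ
  ⟨Span, w ⟩≡0 gs⊥w (span-zero v≈0) = dot-zeroˡ T w v≈0
  ⟨Span, w ⟩≡0 {v = v} gs⊥w (span-add {g} {u} g∈ a su v≈) = begin
    ⟨ v , w ⟩                         ≡⟨ dot-congˡ T w v≈ ⟩
    ⟨ (λ x → a * g x + u x) , w ⟩     ≡⟨ dot-linearˡ T a g u w ⟩
    a * ⟨ g , w ⟩ + ⟨ u , w ⟩         ≡⟨ cong₂ (λ p q → a * p + q) (gs⊥w g g∈) (⟨Span, w ⟩≡0 gs⊥w su) ⟩
    a * 0ℚ + 0ℚ                       ≡⟨ solve 1 (λ a → a :* con 0ℚ :+ con 0ℚ := con 0ℚ) refl a ⟩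
    0ℚ                                ∎
    where open ≡-Reasoning

  ⟨_,Span⟩≡0 : ∀ w {gs v} → (∀ g → g ∈ gs → ⟨ w , g ⟩ ≡ 0ℚ) → Span gs v → ⟨ w , v ⟩ ≡ 0ℚ
  ⟨ w ,Span⟩≡0 w⊥gs sv = trans (dot-comm T w _) (⟨Span, w ⟩≡0 (λ g g∈ → trans (dot-comm T g w) (w⊥gs g g∈)) sv)

  data Orthogonal : List Vector → Set where
    []   : Orthogonal []
    cons : ∀ {o os} → ⟨ o , o ⟩ ≢ 0ℚ → (∀ o′ → o′ ∈ os → ⟨ o , o′ ⟩ ≡ 0ℚ) → Orthogonal os →
           Orthogonal (o ∷ os)

  coefficient : Vector → Vector → ℚ
  coefficient v o = ⟨ v , o ⟩ * recip ⟨ o , o ⟩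

  projection : List Vector → Vector → Vector
  projection []       v x = 0ℚ
  projection (o ∷ os) v x = coefficient v o * o x + projection os v x

  residual : List Vector → Vector → Vector
  residual O v x = v x - projection O v x

  projection-Span : ∀ os v → Span os (projection os v)
  projection-Span []       v = span-zero (λ _ _ → refl)
  projection-Span (o ∷ os) v =
    span-add (here refl) (coefficient v o) (Span-mono (λ _ → there) (projection-Span os v)) (λ _ _ → refl)

  ⟨projection,o⟩≡⟨v,o⟩ : ∀ {os} v → Orthogonal os → ∀ {o′} → o′ ∈ os → ⟨ projection os v , o′ ⟩ ≡ ⟨ v , o′ ⟩
  ⟨projection,o⟩≡⟨v,o⟩ {o ∷ os} v (cons o≢0 o⊥os os⊥) (here refl) = begin
    ⟨ projection (o ∷ os) v , o ⟩                 ≡⟨ dot-linearˡ T (coefficient v o) o (projection os v) o ⟩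
    coefficient v o * ⟨ o , o ⟩ + ⟨ projection os v , o ⟩
      ≡⟨ cong (coefficient v o * ⟨ o , o ⟩ +_)
              (⟨Span, o ⟩≡0 (λ g g∈ → trans (dot-comm T g o) (o⊥os g g∈)) (projection-Span os v)) ⟩
    coefficient v o * ⟨ o , o ⟩ + 0ℚ               ≡⟨ +-identityʳ _ ⟩
    ⟨ v , o ⟩ * recip ⟨ o , o ⟩ * ⟨ o , o ⟩          ≡⟨ *-assoc ⟨ v , o ⟩ _ _ ⟩
    ⟨ v , o ⟩ * (recip ⟨ o , o ⟩ * ⟨ o , o ⟩)
      ≡⟨ cong (⟨ v , o ⟩ *_) (trans (*-comm _ ⟨ o , o ⟩) (x*recip[x]≡1 _ o≢0)) ⟩
    ⟨ v , o ⟩ * 1ℚ                                 ≡⟨ *-identityʳ _ ⟩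
    ⟨ v , o ⟩                                      ∎
    where open ≡-Reasoning
  ⟨projection,o⟩≡⟨v,o⟩ {o ∷ os} v (cons o≢0 o⊥os os⊥) {o′} (there o′∈os) = begin
    ⟨ projection (o ∷ os) v , o′ ⟩                          ≡⟨ dot-linearˡ T (coefficient v o) o (projection os v) o′ ⟩
    coefficient v o * ⟨ o , o′ ⟩ + ⟨ projection os v , o′ ⟩  ≡⟨ cong₂ (λ p q → coefficient v o * p + q)
                                                                      (o⊥os o′ o′∈os) (⟨projection,o⟩≡⟨v,o⟩ v os⊥ o′∈os) ⟩
    coefficient v o * 0ℚ + ⟨ v , o′ ⟩
      ≡⟨ solve 2 (λ c a → c :* con 0ℚ :+ a := a) refl (coefficient v o) ⟨ v , o′ ⟩ ⟩
    ⟨ v , o′ ⟩                                              ∎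
    where open ≡-Reasoning

  residual-⊥ : ∀ {O} v → Orthogonal O → ∀ o → o ∈ O → ⟨ residual O v , o ⟩ ≡ 0ℚ
  residual-⊥ {O} v O⊥ o o∈O = begin
    ⟨ residual O v , o ⟩                   ≡⟨ dot-subˡ T v (projection O v) o ⟩
    ⟨ v , o ⟩ - ⟨ projection O v , o ⟩     ≡⟨ cong (λ q → ⟨ v , o ⟩ - q) (⟨projection,o⟩≡⟨v,o⟩ v O⊥ o∈O) ⟩
    ⟨ v , o ⟩ - ⟨ v , o ⟩                  ≡⟨ +-inverseʳ ⟨ v , o ⟩ ⟩
    0ℚ                                     ∎
    where open ≡-Reasoning

  residual-⊥-Span : ∀ {O} v → Orthogonal O → ∀ {w} → Span O w → ⟨ residual O v , w ⟩ ≡ 0ℚ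
  residual-⊥-Span {O} v O⊥ = ⟨ residual O v ,Span⟩≡0 (residual-⊥ v O⊥)

  ⟨residual,v⟩≡⟨residual,residual⟩ : ∀ {O} v → Orthogonal O → ⟨ residual O v , v ⟩ ≡ ⟨ residual O v , residual O v ⟩
  ⟨residual,v⟩≡⟨residual,residual⟩ {O} v O⊥ = begin
    ⟨ r , v ⟩                                        ≡⟨ dot-comm T r v ⟩
    ⟨ v , r ⟩
      ≡⟨ solve 2 (λ a b → a := (a :- b) :+ b) refl ⟨ v , r ⟩ ⟨ projection O v , r ⟩ ⟩
    (⟨ v , r ⟩ - ⟨ projection O v , r ⟩) + ⟨ projection O v , r ⟩
      ≡⟨ cong₂ _+_ (sym (dot-subˡ T v (projection O v) r)) (trans (dot-comm T _ r) (residual-⊥-Span v O⊥ (projection-Span O v))) ⟩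
    ⟨ r , r ⟩ + 0ℚ                                   ≡⟨ +-identityʳ _ ⟩
    ⟨ r , r ⟩                                        ∎
    where
    open ≡-Reasoning
    r = residual O v

  ⟨residual,residual⟩≡0⇒Span : ∀ O v → ⟨ residual O v , residual O v ⟩ ≡ 0ℚ → Span O v
  ⟨residual,residual⟩≡0⇒Span O v rr≡0 = Span-resp-≈ (projection-Span O v) (λ x x∈ → begin
    projection O v x                         ≡⟨ solve 2 (λ p v → p := v :- (v :- p)) refl (projection O v x) (v x) ⟩
    v x - residual O v x                     ≡⟨ cong (λ q → v x - q) (dot-self≡0⇒≡0 T (residual O v) rr≡0 x x∈) ⟩
    v x - 0ℚ                                 ≡⟨ solve 1 (λ v → v :- con 0ℚ := v) refl (v x) ⟩
    v x                                      ∎)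
    where open ≡-Reasoning

  -- Gram–Schmidt: extend the orthogonal family O by the residuals of the candidates (processed
  -- right to left); the second component lists the candidates whose residual was kept.
  adjoin : (O zs : List Vector) (c : Vector) → Dec (⟨ residual O c , residual O c ⟩ ≡ 0ℚ) → List Vector × List Vector
  adjoin O zs c (yes _) = O , zs
  adjoin O zs c (no _)  = residual O c ∷ O , c ∷ zs

  adjoin? : List Vector × List Vector → Vector → List Vector × List Vector
  adjoin? (O , zs) c = adjoin O zs c (⟨ residual O c , residual O c ⟩ ≟ 0ℚ)

  gramSchmidt : List Vector → List Vector → List Vector × List Vector
  gramSchmidt O []       = O , []
  gramSchmidt O (c ∷ cs) = adjoin? (gramSchmidt O cs) c

  record IsGramSchmidt (O cs O′ zs : List Vector) : Set where
    field
      orthogonal     : Orthogonal O′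
      base⊆          : ∀ g → g ∈ O → Span O′ g
      kept⊆          : ∀ z → z ∈ zs → Span O′ z
      candidates⊆    : ∀ c → c ∈ cs → Span O′ c
      ⊆base++kept    : ∀ o → o ∈ O′ → Span (O ++ zs) o
      kept⊆candidates : ∀ z → z ∈ zs → z ∈ cs
  open IsGramSchmidt

  private
    ++-∷ʳ : ∀ (O : List Vector) {zs} c g → g ∈ O ++ zs → g ∈ O ++ (c ∷ zs)
    ++-∷ʳ O c g g∈ with ∈-++⁻ O g∈
    ... | inj₁ g∈O  = ∈-++⁺ˡ g∈O
    ... | inj₂ g∈zs = ∈-++⁺ʳ O (there g∈zs)

  adjoin-correct : ∀ {O cs O′ zs} c (r≡0? : Dec (⟨ residual O′ c , residual O′ c ⟩ ≡ 0ℚ)) → IsGramSchmidt O cs O′ zs →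
                   IsGramSchmidt O (c ∷ cs) (proj₁ (adjoin O′ zs c r≡0?)) (proj₂ (adjoin O′ zs c r≡0?))
  adjoin-correct c (yes r≡0) G = record
    { orthogonal = orthogonal G ; base⊆ = base⊆ G ; kept⊆ = kept⊆ G
    ; candidates⊆ = λ { _ (here refl) → ⟨residual,residual⟩≡0⇒Span _ c r≡0 ; c′ (there c′∈) → candidates⊆ G c′ c′∈ }
    ; ⊆base++kept = ⊆base++kept G
    ; kept⊆candidates = λ z z∈ → there (kept⊆candidates G z z∈) }
  adjoin-correct {O} {cs} {O′} {zs} c (no r≢0) G = record
    { orthogonal = cons r≢0 (λ o o∈ → residual-⊥ c (orthogonal G) o o∈) (orthogonal G)
    ; base⊆ = λ g g∈ → Span-mono (λ _ → there) (base⊆ G g g∈)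
    ; kept⊆ = λ { _ (here refl) → c∈⟨r∷O′⟩ ; z (there z∈) → Span-mono (λ _ → there) (kept⊆ G z z∈) }
    ; candidates⊆ = λ { _ (here refl) → c∈⟨r∷O′⟩ ; c′ (there c′∈) → Span-mono (λ _ → there) (candidates⊆ G c′ c′∈) }
    ; ⊆base++kept = λ
        { _ (here refl) → Span-- (Span-∈ (∈-++⁺ʳ O (here refl)))
                                 (Span-mono (++-∷ʳ O c) (Span-trans (⊆base++kept G) (projection-Span O′ c)))
        ; o (there o∈) → Span-mono (++-∷ʳ O c) (⊆base++kept G o o∈) }
    ; kept⊆candidates = λ { _ (here refl) → here refl ; z (there z∈) → there (kept⊆candidates G z z∈) } }
    where
    c∈⟨r∷O′⟩ : Span (residual O′ c ∷ O′) c
    c∈⟨r∷O′⟩ = span-add (here refl) 1ℚ (Span-mono (λ _ → there) (projection-Span O′ c))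
      (λ x _ → solve 2 (λ c p → c := con 1ℚ :* (c :- p) :+ p) refl (c x) (projection O′ c x))

  gramSchmidt-correct : ∀ O cs → Orthogonal O → IsGramSchmidt O cs (proj₁ (gramSchmidt O cs)) (proj₂ (gramSchmidt O cs))
  gramSchmidt-correct O [] O⊥ = record
    { orthogonal = O⊥ ; base⊆ = λ _ → Span-∈ ; kept⊆ = λ _ () ; candidates⊆ = λ _ ()
    ; ⊆base++kept = λ _ o∈ → Span-∈ (∈-++⁺ˡ o∈) ; kept⊆candidates = λ _ () }
  gramSchmidt-correct O (c ∷ cs) O⊥ with gramSchmidt O cs | gramSchmidt-correct O cs O⊥
  ... | O′ , zs | G = adjoin-correct c (⟨ residual O′ c , residual O′ c ⟩ ≟ 0ℚ) G

  orthogonalBasis : List Vector → List Vector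
  orthogonalBasis gs = proj₁ (gramSchmidt [] gs)

  orthogonalBasis-correct : ∀ gs → IsGramSchmidt [] gs (orthogonalBasis gs) (proj₂ (gramSchmidt [] gs))
  orthogonalBasis-correct gs = gramSchmidt-correct [] gs []

  orthogonalBasis⊆Span : ∀ gs o → o ∈ orthogonalBasis gs → Span gs o
  orthogonalBasis⊆Span gs o o∈ = Span-mono (kept⊆candidates G) (⊆base++kept G o o∈)
    where G = orthogonalBasis-correct gs

  -- p is built one s at a time as t · r + p, where the residual r of b s modulo Bg is orthogonal
  -- to Bg with ⟨ b s , r ⟩ = ⟨ r , r ⟩ ≢ 0, and t avoids finitely many bad values.
  separating-vector : (Bg : List Vector) {S : Set} (C : List S) (b : S → Vector) →
    (∀ s → s ∈ C → ¬ Span Bg (b s)) →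
    ∃ λ p → Bg ⊥ p × (∀ s → s ∈ C → ⟨ b s , p ⟩ ≢ 0ℚ)
  separating-vector Bg [] b _ = 0ᵛ , (λ g _ → dot-zeroʳ T g (λ _ _ → refl)) , (λ _ ())
  separating-vector Bg (s ∷ C) b ∉Span with separating-vector Bg C b (λ s′ s′∈ → ∉Span s′ (there s′∈))
  ... | p , Bg⊥p , p-separates = p′ , Bg⊥p′ , p′-separates
    where
    G = orthogonalBasis-correct Bg
    r = residual (orthogonalBasis Bg) (b s)

    Bg⊥r : Bg ⊥ r
    Bg⊥r g g∈ = trans (dot-comm T g r) (residual-⊥-Span (b s) (orthogonal G) (candidates⊆ G g g∈))

    ⟨bs,r⟩≢0 : ⟨ b s , r ⟩ ≢ 0ℚ
    ⟨bs,r⟩≢0 ⟨bs,r⟩≡0 = ∉Span s (here refl) (Span-trans (orthogonalBasis⊆Span Bg)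
      (⟨residual,residual⟩≡0⇒Span _ (b s)
        (trans (sym (⟨residual,v⟩≡⟨residual,residual⟩ (b s) (orthogonal G))) (trans (dot-comm T r (b s)) ⟨bs,r⟩≡0))))

    t-avoids = avoid-roots (s ∷ C) (λ j → ⟨ b j , p ⟩) (λ j → ⟨ b j , r ⟩)
      (λ { _ (here refl) → inj₁ ⟨bs,r⟩≢0 ; j (there j∈) → inj₂ (p-separates j j∈) })
    t = proj₁ t-avoids

    p′ : Vector
    p′ x = t * r x + p x

    ⟨g,p′⟩ : ∀ g → ⟨ g , p′ ⟩ ≡ t * ⟨ g , r ⟩ + ⟨ g , p ⟩
    ⟨g,p′⟩ g = trans (dot-comm T g p′) (trans (dot-linearˡ T t r p g) (cong₂ (λ u v → t * u + v) (dot-comm T r g) (dot-comm T p g)))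

    Bg⊥p′ : Bg ⊥ p′
    Bg⊥p′ g g∈ = trans (⟨g,p′⟩ g) (trans (cong₂ (λ u v → t * u + v) (Bg⊥r g g∈) (Bg⊥p g g∈))
                                         (solve 1 (λ t → t :* con 0ℚ :+ con 0ℚ := con 0ℚ) refl t))

    p′-separates : ∀ j → j ∈ s ∷ C → ⟨ b j , p′ ⟩ ≢ 0ℚ
    p′-separates j j∈ ⟨bj,p′⟩≡0 = proj₂ t-avoids j j∈ (trans (sym (⟨g,p′⟩ (b j))) ⟨bj,p′⟩≡0)

  combination-Span : ∀ zs a → Span zs (combination zs a)
  combination-Span []       a = span-zero (λ _ _ → refl)
  combination-Span (z ∷ zs) a = span-add (here refl) (a zero) (Span-mono (λ _ → there) (combination-Span zs (a ∘ suc))) (λ _ _ → refl)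

  Span-++⇒Span-combination : ∀ Bg zs {y} → Span (Bg ++ zs) y → ∃ λ a → Span Bg (λ x → y x - combination zs a x)
  Span-++⇒Span-combination Bg zs (span-zero y≈0) =
    (λ _ → 0ℚ) , span-zero (λ x x∈ → cong₂ _-_ (y≈0 x x∈) (combination-zero zs x))
  Span-++⇒Span-combination Bg zs {y} (span-add {g} {u} g∈ b su y≈) with Span-++⇒Span-combination Bg zs su | ∈-++⁻ Bg g∈
  ... | a , su′ | inj₁ g∈Bg = a , span-add g∈Bg b su′ (λ x x∈ → trans (cong (λ q → q - combination zs a x) (y≈ x x∈))
    (solve 4 (λ b g u l → b :* g :+ u :- l := b :* g :+ (u :- l)) refl b (g x) (u x) (combination zs a x)))
  ... | a , su′ | inj₂ g∈zs with combination-∈ zs g∈zs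
  ... | ag , ag↦g = (λ i → a i + b * ag i) , Span-resp-≈ su′ (λ x x∈ → begin
    u x - combination zs a x
      ≡⟨ solve 4 (λ b g u l → u :- l := (b :* g :+ u) :- (l :+ b :* g)) refl b (g x) (u x) (combination zs a x) ⟩
    (b * g x + u x) - (combination zs a x + b * g x)
      ≡⟨ cong₂ (λ p q → p - (combination zs a x + q)) (sym (y≈ x x∈))
               (sym (trans (combination-* zs ag b x) (cong (b *_) (ag↦g x)))) ⟩
    y x - (combination zs a x + combination zs (λ i → b * ag i) x)
      ≡⟨ cong (λ q → y x - q) (sym (combination-+ zs a (λ i → b * ag i) x)) ⟩
    y x - combination zs (λ i → a i + b * ag i) x ∎)
    where open ≡-Reasoning

  IndependentModulo : List Vector → List Vector → Set
  IndependentModulo Bg zs = ∀ a → Span Bg (combination zs a) → ∀ i → a i ≡ 0ℚ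

  -- Pairing with the new residual r annihilates Span O′ (which contains Bg and the earlier kept
  -- vectors) and sends c to ⟨ r , r ⟩ ≢ 0, so the coefficient of c must vanish.
  adjoin-independent : ∀ Bg {O cs O′ zs} c (r≡0? : Dec (⟨ residual O′ c , residual O′ c ⟩ ≡ 0ℚ)) →
    IsGramSchmidt O cs O′ zs → (∀ g → g ∈ Bg → Span O g) →
    IndependentModulo Bg zs → IndependentModulo Bg (proj₂ (adjoin O′ zs c r≡0?))
  adjoin-independent Bg c (yes _) G Bg⊆⟨O⟩ zs-indep = zs-indep
  adjoin-independent Bg {O′ = O′} {zs} c (no r≢0) G Bg⊆⟨O⟩ zs-indep a ⟨Bg⟩∋ = a≡0
    where
    r = residual O′ c
    ⟨r,combination⟩≡0 : ⟨ r , combination (c ∷ zs) a ⟩ ≡ 0ℚ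
    ⟨r,combination⟩≡0 = residual-⊥-Span c (orthogonal G) (Span-trans (λ g g∈ → Span-trans (base⊆ G) (Bg⊆⟨O⟩ g g∈)) ⟨Bg⟩∋)
    ⟨combination,r⟩≡0 : ⟨ combination zs (a ∘ suc) , r ⟩ ≡ 0ℚ
    ⟨combination,r⟩≡0 = trans (dot-comm T _ r) (residual-⊥-Span c (orthogonal G) (Span-trans (kept⊆ G) (combination-Span zs (a ∘ suc))))
    a₀*⟨r,r⟩≡0 : a zero * ⟨ r , r ⟩ ≡ 0ℚ
    a₀*⟨r,r⟩≡0 = begin
      a zero * ⟨ r , r ⟩
        ≡⟨ cong (a zero *_) (sym (trans (dot-comm T c r) (⟨residual,v⟩≡⟨residual,residual⟩ c (orthogonal G)))) ⟩
      a zero * ⟨ c , r ⟩                                   ≡⟨ sym (+-identityʳ _) ⟩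
      a zero * ⟨ c , r ⟩ + 0ℚ                              ≡⟨ cong (a zero * ⟨ c , r ⟩ +_) (sym ⟨combination,r⟩≡0) ⟩
      a zero * ⟨ c , r ⟩ + ⟨ combination zs (a ∘ suc) , r ⟩ ≡⟨ sym (dot-linearˡ T (a zero) c (combination zs (a ∘ suc)) r) ⟩
      ⟨ combination (c ∷ zs) a , r ⟩                        ≡⟨ dot-comm T _ r ⟩
      ⟨ r , combination (c ∷ zs) a ⟩                        ≡⟨ ⟨r,combination⟩≡0 ⟩
      0ℚ                                                   ∎
      where open ≡-Reasoning
    a₀≡0 : a zero ≡ 0ℚ
    a₀≡0 = x*y≡0⇒x≡0 (a zero) a₀*⟨r,r⟩≡0 r≢0
    a≡0 : ∀ i → a i ≡ 0ℚ
    a≡0 zero    = a₀≡0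
    a≡0 (suc i) = zs-indep (a ∘ suc) (Span-resp-≈ ⟨Bg⟩∋ (λ x _ →
      trans (cong (λ q → q * c x + combination zs (a ∘ suc) x) a₀≡0)
            (solve 2 (λ c l → con 0ℚ :* c :+ l := l) refl (c x) (combination zs (a ∘ suc) x)))) i

  gramSchmidt-independent : ∀ Bg O cs → Orthogonal O → (∀ g → g ∈ Bg → Span O g) → IndependentModulo Bg (proj₂ (gramSchmidt O cs))
  gramSchmidt-independent Bg O []       O⊥ Bg⊆⟨O⟩ a _ ()
  gramSchmidt-independent Bg O (c ∷ cs) O⊥ Bg⊆⟨O⟩
    with gramSchmidt O cs | gramSchmidt-correct O cs O⊥ | gramSchmidt-independent Bg O cs O⊥ Bg⊆⟨O⟩
  ... | O′ , zs | G | zs-indep = adjoin-independent Bg c (⟨ residual O′ c , residual O′ c ⟩ ≟ 0ℚ) G Bg⊆⟨O⟩ zs-indep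

  weightedSum-Span : ∀ {Y : Set} {gs} (J : List Y) f a → (∀ j → j ∈ J → Span gs (f j)) → Span gs (weightedSum J f a)
  weightedSum-Span []      f a fJ⊆⟨gs⟩ = span-zero (λ _ _ → refl)
  weightedSum-Span (j ∷ J) f a fJ⊆⟨gs⟩ =
    Span-resp-≈ (Span-+ (Span-* (a j) (fJ⊆⟨gs⟩ j (here refl)))
                        (weightedSum-Span J f a (λ j′ j′∈ → fJ⊆⟨gs⟩ j′ (there j′∈))))
                (λ x _ → cong (_+ weightedSum J f a x) (*-comm (a j) (f j x)))

  record QuotientBasis (rs Bg : List Vector) : Set where
    field
      basis       : List Vector
      basis⊥      : ∀ z → z ∈ basis → rs ⊥ z
      independent : IndependentModulo Bg basis
      spanning    : ∀ y → rs ⊥ y → ∃ λ a → Span Bg (λ x → y x - combination basis a x)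

  -- The residuals modulo rs of the coordinate vectors e τ span rs^⊥; extending an orthogonal
  -- basis of Span Bg by them, Gram–Schmidt keeps a basis of rs^⊥ modulo Bg.
  quotientBasis : (e : X → Vector) → (∀ y → weightedSum T e y ≈ y) → ∀ rs Bg → QuotientBasis rs Bg
  quotientBasis e coordinates rs Bg = record
    { basis = proj₂ extended ; basis⊥ = basis⊥ ; independent = independent ; spanning = spanning }
    where
    GR = orthogonalBasis-correct rs
    GB = orthogonalBasis-correct Bg
    projected candidate : X → Vector
    projected τ = projection (orthogonalBasis rs) (e τ)
    candidate τ = residual (orthogonalBasis rs) (e τ)
    candidates = map candidate T
    extended = gramSchmidt (orthogonalBasis Bg) candidates
    GE = gramSchmidt-correct (orthogonalBasis Bg) candidates (orthogonal GB)

    candidate⊥ : ∀ τ → rs ⊥ candidate τ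
    candidate⊥ τ g g∈ = trans (dot-comm T g _) (residual-⊥-Span (e τ) (orthogonal GR) (candidates⊆ GR g g∈))

    basis⊥ : ∀ z → z ∈ proj₂ extended → rs ⊥ z
    basis⊥ z z∈ with ∈-map⁻ candidate (kept⊆candidates GE z z∈)
    ... | τ , _ , refl = candidate⊥ τ

    independent : IndependentModulo Bg (proj₂ extended)
    independent = gramSchmidt-independent Bg (orthogonalBasis Bg) candidates (orthogonal GB) (candidates⊆ GB)

    -- y minus its expansion in the candidates lies in Span rs and is orthogonal to rs, hence vanishes.
    candidates-span : ∀ y → rs ⊥ y → Span candidates y
    candidates-span y rs⊥y = Span-resp-≈ expansion (λ x x∈ → begin
      weightedSum T candidate y x                         ≡⟨ solve 2 (λ s y → s := y :- (y :- s)) refl (weightedSum T candidate y x) (y x) ⟩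
      y x - (y x - weightedSum T candidate y x)
        ≡⟨ cong (λ q → y x - q) (dot-self≡0⇒≡0 T w (⟨Span, w ⟩≡0 rs⊥w w∈⟨rs⟩) x x∈) ⟩
      y x - 0ℚ                                            ≡⟨ solve 1 (λ y → y :- con 0ℚ := y) refl (y x) ⟩
      y x                                                 ∎)
      where
      open ≡-Reasoning
      expansion : Span candidates (weightedSum T candidate y)
      expansion = weightedSum-Span T candidate y (λ τ τ∈ → Span-∈ (∈-map⁺ candidate τ∈))
      w : Vector
      w x = y x - weightedSum T candidate y x
      w∈⟨rs⟩ : Span rs w
      w∈⟨rs⟩ = Span-trans (orthogonalBasis⊆Span rs) (Span-resp-≈
        (weightedSum-Span T projected y (λ τ _ → projection-Span _ (e τ)))
        (λ x x∈ → begin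
          weightedSum T projected y x
            ≡⟨ solve 2 (λ s q → q := s :- (s :- q)) refl (weightedSum T e y x) (weightedSum T projected y x) ⟩
          weightedSum T e y x - (weightedSum T e y x - weightedSum T projected y x)
            ≡⟨ cong₂ _-_ (coordinates y x x∈) (sym (weightedSum-- T e projected y x)) ⟩
          y x - weightedSum T candidate y x ∎))
      rs⊥w : rs ⊥ w
      rs⊥w g g∈ = begin
        ⟨ g , w ⟩                                                  ≡⟨ dot-comm T g w ⟩
        ⟨ w , g ⟩                                                  ≡⟨ dot-subˡ T y (weightedSum T candidate y) g ⟩
        ⟨ y , g ⟩ - ⟨ weightedSum T candidate y , g ⟩              ≡⟨ cong₂ _-_ (trans (dot-comm T y g) (rs⊥y g g∈))
                                                                          (⟨Span, g ⟩≡0 (λ c c∈ → candidate∈⊥ c c∈) expansion) ⟩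
        0ℚ - 0ℚ                                                    ≡⟨⟩
        0ℚ                                                         ∎
        where
        candidate∈⊥ : ∀ c → c ∈ candidates → ⟨ c , g ⟩ ≡ 0ℚ
        candidate∈⊥ c c∈ with ∈-map⁻ candidate c∈
        ... | τ , _ , refl = trans (dot-comm T _ g) (candidate⊥ τ g g∈)

    spanning : ∀ y → rs ⊥ y → ∃ λ a → Span Bg (λ x → y x - combination (proj₂ extended) a x)
    spanning y rs⊥y = Span-++⇒Span-combination Bg (proj₂ extended)
      (Span-trans (λ g g∈ → base++kept g (∈-++⁻ (orthogonalBasis Bg) g∈))
        (Span-trans (⊆base++kept GE) (Span-trans (candidates⊆ GE) (candidates-span y rs⊥y))))
      where
      base++kept : ∀ g → g ∈ orthogonalBasis Bg ⊎ g ∈ proj₂ extended → Span (Bg ++ proj₂ extended) g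
      base++kept g (inj₁ g∈OB)  = Span-mono (λ _ → ∈-++⁺ˡ) (orthogonalBasis⊆Span Bg g g∈OB)
      base++kept g (inj₂ g∈kept) = Span-∈ (∈-++⁺ʳ Bg g∈kept)

open Coordinates using (Span; span-zero; span-add; Span-resp-≈; Span-∈; Span-trans; Span-mono; weightedSum-Span)
open Equivalence using (to; from)

module _ {n : ℕ} where
  open DecMembership (_≟ₛ_ {n}) using (_∈?_)

  ∈-ofLength⁺ : ∀ m {L} {σ : Simplex n} → σ ∈ L → length σ ≡ m → σ ∈ ofLength m L
  ∈-ofLength⁺ m = ∈-filter⁺ (λ σ → length σ ℕ.≟ m)

  ∈-ofLength⁻ : ∀ m {L} {σ : Simplex n} → σ ∈ ofLength m L → σ ∈ L × length σ ≡ m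
  ∈-ofLength⁻ m {L} = ∈-filter⁻ (λ σ → length σ ℕ.≟ m) {xs = L}

  ofLength-unique : ∀ m {L : List (Simplex n)} → Unique L → Unique (ofLength m L)
  ofLength-unique m = Unique.filter⁺ (λ σ → length σ ℕ.≟ m)

  [ρ≟ρ]≡1 : ∀ (ρ : Simplex n) → [ ρ ≟ ρ ]ℚ ≡ 1ℚ
  [ρ≟ρ]≡1 ρ with ρ ≟ₛ ρ
  ... | yes _   = refl
  ... | no ρ≢ρ = ⊥-elim (ρ≢ρ refl)

  [ρ≟τ]≡0 : ∀ {ρ τ : Simplex n} → ρ ≢ τ → [ ρ ≟ τ ]ℚ ≡ 0ℚ
  [ρ≟τ]≡0 {ρ} {τ} ρ≢τ with ρ ≟ₛ τ
  ... | yes ρ≡τ = ⊥-elim (ρ≢τ ρ≡τ)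
  ... | no _    = refl

  restrict : List (Simplex n) → Chain n → Chain n
  restrict J f ρ with ρ ∈? J
  ... | yes _ = f ρ
  ... | no  _ = 0ℚ

  dot-indicator-∉ : ∀ {ρ} J f → ρ ∉ J → dot J (λ τ → [ ρ ≟ τ ]ℚ) f ≡ 0ℚ
  dot-indicator-∉ {ρ} J f ρ∉J =
    dot-zeroˡ J {λ τ → [ ρ ≟ τ ]ℚ} f (λ τ τ∈J → [ρ≟τ]≡0 {ρ} {τ} (λ { refl → ρ∉J τ∈J }))

  dot-indicator-∈ : ∀ {ρ J} f → Unique J → ρ ∈ J → dot J (λ τ → [ ρ ≟ τ ]ℚ) f ≡ f ρ
  dot-indicator-∈ {ρ} {_ ∷ J} f (ρ∉J ∷ _) (here refl) =
    trans (cong₂ (λ p q → p * f ρ + q) ([ρ≟ρ]≡1 ρ) (dot-indicator-∉ J f (λ ρ∈J → All.lookup ρ∉J ρ∈J refl)))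
          (solve 1 (λ p → con 1ℚ :* p :+ con 0ℚ := p) refl (f ρ))
  dot-indicator-∈ {ρ} {τ ∷ J} f (τ∉J ∷ J!) (there ρ∈J) =
    trans (cong₂ (λ p q → p * f τ + q) ([ρ≟τ]≡0 (λ ρ≡τ → All.lookup τ∉J ρ∈J (sym ρ≡τ))) (dot-indicator-∈ f J! ρ∈J))
          (solve 2 (λ q p → con 0ℚ :* q :+ p := p) refl (f τ) (f ρ))

  dot-indicator : ∀ {J} → Unique J → ∀ ρ f → dot J (λ τ → [ ρ ≟ τ ]ℚ) f ≡ restrict J f ρ
  dot-indicator {J} J! ρ f with ρ ∈? J
  ... | yes ρ∈J = dot-indicator-∈ f J! ρ∈J
  ... | no  ρ∉J = dot-indicator-∉ J f ρ∉J

  -- Faces of σ outside T contribute 0 on both sides; this also covers d = 0, where the face [] is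
  -- not a simplex.
  δ-restrict : ∀ {T} → Unique T → ∀ p σ → δ (restrict T p) σ ≡ dot T (incidence σ) p
  δ-restrict {T} T! p σ = sym (begin
    dot T (incidence σ) p
      ≡⟨ dot-sumˡ T faces (λ i τ → sgn (Fin.toℕ i) * [ removeAt σ i ≟ τ ]ℚ) p ⟩
    sumℚ (map (λ i → dot T (λ τ → sgn (Fin.toℕ i) * [ removeAt σ i ≟ τ ]ℚ) p) faces)
      ≡⟨ cong sumℚ (map-cong (λ i → trans (dot-*ˡ T (sgn (Fin.toℕ i)) _ p)
                                         (cong (sgn (Fin.toℕ i) *_) (dot-indicator T! (removeAt σ i) p))) faces) ⟩
    δ (restrict T p) σ ∎)
    where
    open ≡-Reasoning
    faces = allFin (length σ)

  boundaries : List (Simplex n) → ℕ → List (Chain n)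
  boundaries L d = map incidence (ofLength (suc d) L)

  IsBoundary⇒Span : ∀ {T} L d {z} → (∀ τ → τ ∈ T → τ ∈ L × length τ ≡ d) →
                    IsBoundary L d z → Span T (boundaries L d) z
  IsBoundary⇒Span {T} L d T⊆Lᵈ (Γ , ∂Γ≈z) =
    Span-resp-≈ T (weightedSum-Span T (ofLength (suc d) L) incidence Γ (λ σ σ∈ → Span-∈ T (∈-map⁺ incidence σ∈)))
      (λ τ τ∈T → ∂Γ≈z τ (proj₁ (T⊆Lᵈ τ τ∈T)) (proj₂ (T⊆Lᵈ τ τ∈T)))

  Span⇒IsBoundary : ∀ {T} L d {z} → Unique L → (∀ τ → τ ∈ L → length τ ≡ d → τ ∈ T) →
                    Span T (boundaries L d) z → IsBoundary L d z
  Span⇒IsBoundary L d L! Lᵈ⊆T (span-zero z≈0) =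
    zeroC , λ τ τ∈L |τ|≡d → trans (dot-zeroʳ (ofLength (suc d) L) (λ σ′ → incidence σ′ τ) (λ _ _ → refl))
                                  (sym (z≈0 τ (Lᵈ⊆T τ τ∈L |τ|≡d)))
  Span⇒IsBoundary L d {z} L! Lᵈ⊆T (span-add {u = u} g∈ a su z≈) with ∈-map⁻ incidence g∈ | Span⇒IsBoundary L d L! Lᵈ⊆T su
  ... | σ , σ∈S , refl | Γ , ∂Γ≈u = Γ′ , λ τ τ∈L |τ|≡d → begin
    ∂[ L , suc d ] Γ′ τ                                        ≡⟨ dot-comm S (λ σ′ → incidence σ′ τ) Γ′ ⟩
    dot S Γ′ (λ σ′ → incidence σ′ τ)                           ≡⟨ dot-linearˡ S a (λ ρ → [ σ ≟ ρ ]ℚ) Γ (λ σ′ → incidence σ′ τ) ⟩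
    a * dot S (λ ρ → [ σ ≟ ρ ]ℚ) (λ σ′ → incidence σ′ τ) + dot S Γ (λ σ′ → incidence σ′ τ)
      ≡⟨ cong₂ (λ p q → a * p + q) (dot-indicator-∈ (λ σ′ → incidence σ′ τ) S! σ∈S) (dot-comm S Γ _) ⟩
    a * incidence σ τ + ∂[ L , suc d ] Γ τ                    ≡⟨ cong (a * incidence σ τ +_) (∂Γ≈u τ τ∈L |τ|≡d) ⟩
    a * incidence σ τ + u τ                                   ≡⟨ sym (z≈ τ (Lᵈ⊆T τ τ∈L |τ|≡d)) ⟩
    z τ                                                       ∎
    where
    open ≡-Reasoning
    S = ofLength (suc d) L
    S! : Unique S
    S! = ofLength-unique (suc d) L!
    Γ′ : Chain n
    Γ′ ρ = a * [ σ ≟ ρ ]ℚ + Γ ρ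

  lincomb-lookup : ∀ zs a (x : Simplex n) → lincomb a (lookup zs) x ≡ combination zs a x
  lincomb-lookup []       a x = refl
  lincomb-lookup (z ∷ zs) a x = cong (a zero * z x +_) (trans (cong sumℚ shift) (lincomb-lookup zs (a ∘ suc) x))
    where
    term : Fin (suc (length zs)) → ℚ
    term i = a i * lookup (z ∷ zs) i x
    shift : map term (tabulate suc) ≡ map (term ∘ suc) (allFin (length zs))
    shift = trans (map-tabulate suc term) (sym (map-tabulate (λ i → i) (term ∘ suc)))

  module _ (L : List (Simplex n)) (d : ℕ) where
    open Coordinates (ofLength d L) using (_⊥_; QuotientBasis; quotientBasis)

    cycleRelations : List (Chain n)
    cycleRelations = map (λ ρ σ → incidence σ ρ) (filter (λ ρ → suc (length ρ) ℕ.≟ d) L)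

    IsCycle⇒⊥ : ∀ {y} → IsCycle L d y → cycleRelations ⊥ y
    IsCycle⇒⊥ y-cycle g g∈ with ∈-map⁻ (λ ρ σ → incidence σ ρ) g∈
    ... | ρ , ρ∈ , refl = y-cycle ρ (proj₁ ρ∈L×) (proj₂ ρ∈L×)
      where ρ∈L× = ∈-filter⁻ (λ ρ → suc (length ρ) ℕ.≟ d) {xs = L} ρ∈

    ⊥⇒IsCycle : ∀ {y} → cycleRelations ⊥ y → IsCycle L d y
    ⊥⇒IsCycle ⊥y ρ ρ∈L |ρ|+1≡d =
      ⊥y _ (∈-map⁺ (λ ρ σ → incidence σ ρ) (∈-filter⁺ (λ ρ → suc (length ρ) ℕ.≟ d) ρ∈L |ρ|+1≡d))

    homologyDim : Unique L → ∃ λ r → HomologyDim L d r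
    homologyDim L! = length basis , lookup basis , cycles , independent′ , spanning′
      where
      T = ofLength d L
      T⊆Lᵈ : ∀ τ → τ ∈ T → τ ∈ L × length τ ≡ d
      T⊆Lᵈ τ = ∈-ofLength⁻ d
      Lᵈ⊆T : ∀ τ → τ ∈ L → length τ ≡ d → τ ∈ T
      Lᵈ⊆T τ = ∈-ofLength⁺ d
      T! : Unique T
      T! = ofLength-unique d L!

      QB : QuotientBasis cycleRelations (boundaries L d)
      QB = quotientBasis (λ τ x → [ x ≟ τ ]ℚ) (λ y x x∈T → dot-indicator-∈ y T! x∈T) cycleRelations (boundaries L d)
      open QuotientBasis QB

      cycles : ∀ i → IsCycle L d (lookup basis i)
      cycles i = ⊥⇒IsCycle (basis⊥ (lookup basis i) (∈-lookup i))

      independent′ : ∀ a → IsBoundary L d (lincomb a (lookup basis)) → ∀ i → a i ≡ 0ℚ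
      independent′ a boundary =
        independent a (Span-resp-≈ T (IsBoundary⇒Span L d T⊆Lᵈ boundary) (λ x _ → lincomb-lookup basis a x))

      spanning′ : ∀ y → IsCycle L d y → ∃ λ a → IsBoundary L d (λ τ → y τ - lincomb a (lookup basis) τ)
      spanning′ y y-cycle = a , Span⇒IsBoundary L d L! Lᵈ⊆T
        (Span-resp-≈ T (proj₂ y-expansion) (λ x _ → cong (λ q → y x - q) (sym (lincomb-lookup basis a x))))
        where
        y-expansion = spanning y (IsCycle⇒⊥ y-cycle)
        a = proj₁ y-expansion

  ∈-∖⁻ : ∀ (K : Complex n) C {σ} → σ ∈ K ∖ C → σ ∈ simplices K × σ ∉ C
  ∈-∖⁻ K C = ∈-filter⁻ (λ σ → ¬? (σ ∈? C)) {xs = simplices K}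

  ∈-∖⁺ : ∀ (K : Complex n) C {σ} → σ ∈ simplices K → σ ∉ C → σ ∈ K ∖ C
  ∈-∖⁺ K C = ∈-filter⁺ (λ σ → ¬? (σ ∈? C))

  ofLength-filter-∉ : ∀ C m (xs : List (Simplex n)) → (∀ c → c ∈ C → length c ≢ m) →
                      ofLength m (filter (λ σ → ¬? (σ ∈? C)) xs) ≡ ofLength m xs
  ofLength-filter-∉ C m []       C≢m = refl
  ofLength-filter-∉ C m (x ∷ xs) C≢m with x ∈? C
  ... | yes x∈C = trans (ofLength-filter-∉ C m xs C≢m) (sym (filter-reject (λ σ → length σ ℕ.≟ m) {x} {xs} (C≢m x x∈C)))
  ... | no  _ with length x ℕ.≟ m
  ...   | yes |x|≡m = trans (filter-accept P {x} {xs∖C} |x|≡m)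
    (trans (cong (x ∷_) (ofLength-filter-∉ C m xs C≢m)) (sym (filter-accept P {x} {xs} |x|≡m)))
    where
    P = λ σ → length σ ℕ.≟ m
    xs∖C = filter (λ σ → ¬? (σ ∈? C)) xs
  ...   | no  |x|≢m = trans (filter-reject P {x} {xs∖C} |x|≢m)
    (trans (ofLength-filter-∉ C m xs C≢m) (sym (filter-reject P {x} {xs} |x|≢m)))
    where
    P = λ σ → length σ ℕ.≟ m
    xs∖C = filter (λ σ → ¬? (σ ∈? C)) xs

  HomologyDim-cong : ∀ {L L′ : List (Simplex n)} {d r} →
                     (∀ y → IsCycle L d y ⇔ IsCycle L′ d y) → (∀ z → IsBoundary L d z ⇔ IsBoundary L′ d z) →
                     HomologyDim L d r → HomologyDim L′ d r
  HomologyDim-cong same-cycles same-boundaries (z , z-cycles , independent , spanning) =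
    z , (λ i → to (same-cycles (z i)) (z-cycles i)) , (λ a b → independent a (from (same-boundaries _) b)) ,
    λ y y-cycle → proj₁ (spanning y (from (same-cycles y) y-cycle)) ,
                  to (same-boundaries _) (proj₂ (spanning y (from (same-cycles y) y-cycle)))

  boundaries-mono : ∀ {L L′} d → L ⊆ˢ L′ → ∀ g → g ∈ boundaries L d → g ∈ boundaries L′ d
  boundaries-mono {L} d L⊆L′ g g∈ with ∈-map⁻ incidence g∈
  ... | σ , σ∈Lᵈ⁺¹ , refl = ∈-map⁺ incidence (∈-ofLength⁺ (suc d) (L⊆L′ σ (proj₁ σ∈L×)) (proj₂ σ∈L×))
    where σ∈L× = ∈-ofLength⁻ (suc d) {L} σ∈Lᵈ⁺¹

  module _ (K : Complex n) (d : ℕ) where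

    T₀ : List (Simplex n)
    T₀ = ofLength d (simplices K)

    ∖-unique : ∀ C → Unique (K ∖ C)
    ∖-unique C = Unique.filter⁺ (λ σ → ¬? (σ ∈? C)) (unique K)

    ∈ᵈ⁺¹⇒length : ∀ {C} → C ⊆ˢ ofLength (suc d) (simplices K) → ∀ c → c ∈ C → length c ≡ suc d
    ∈ᵈ⁺¹⇒length C⊆ c c∈C = proj₂ (∈-ofLength⁻ (suc d) {simplices K} (C⊆ c c∈C))

    IsCycle-∖ : ∀ {C} → C ⊆ˢ ofLength (suc d) (simplices K) → ∀ y → IsCycle (K ∖ C) d y ⇔ IsCycle (simplices K) d y
    IsCycle-∖ {C} C⊆ y = mk⇔
      (λ y-cycle ρ ρ∈K |ρ|+1≡d → trans (sym (∂-∖ ρ)) (y-cycle ρ (∈-∖⁺ K C ρ∈K (ρ∉C |ρ|+1≡d)) |ρ|+1≡d))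
      (λ y-cycle ρ ρ∈K∖C |ρ|+1≡d → trans (∂-∖ ρ) (y-cycle ρ (proj₁ (∈-∖⁻ K C ρ∈K∖C)) |ρ|+1≡d))
      where
      ∂-∖ : ∀ ρ → ∂[ K ∖ C , d ] y ρ ≡ ∂[ simplices K , d ] y ρ
      ∂-∖ ρ = cong (λ S → sumℚ (map (λ σ → incidence σ ρ * y σ) S))
        (ofLength-filter-∉ C d (simplices K) (λ c c∈C |c|≡d → ℕ.1+n≢n (trans (sym (∈ᵈ⁺¹⇒length C⊆ c c∈C)) |c|≡d)))
      ρ∉C : ∀ {ρ} → suc (length ρ) ≡ d → ρ ∉ C
      ρ∉C {ρ} |ρ|+1≡d ρ∈C = ℕ.m≢1+n+m d {1} (sym (trans (cong suc (sym (∈ᵈ⁺¹⇒length C⊆ ρ ρ∈C))) |ρ|+1≡d))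

    IsBoundary-∖⇔Span : ∀ {C} → C ⊆ˢ ofLength (suc d) (simplices K) →
                        ∀ z → IsBoundary (K ∖ C) d z ⇔ Span T₀ (boundaries (K ∖ C) d) z
    IsBoundary-∖⇔Span {C} C⊆ z = mk⇔ (IsBoundary⇒Span (K ∖ C) d T₀⊆) (Span⇒IsBoundary (K ∖ C) d (∖-unique C) ⊆T₀)
      where
      T₀⊆ : ∀ τ → τ ∈ T₀ → τ ∈ K ∖ C × length τ ≡ d
      T₀⊆ τ τ∈T₀ = ∈-∖⁺ K C τ∈K (λ τ∈C → ℕ.1+n≢n (trans (sym (∈ᵈ⁺¹⇒length C⊆ τ τ∈C)) |τ|≡d)) , |τ|≡d
        where
        τ∈K = proj₁ (∈-ofLength⁻ d {simplices K} τ∈T₀)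
        |τ|≡d = proj₂ (∈-ofLength⁻ d {simplices K} τ∈T₀)
      ⊆T₀ : ∀ τ → τ ∈ K ∖ C → length τ ≡ d → τ ∈ T₀
      ⊆T₀ τ τ∈K∖C = ∈-ofLength⁺ d (proj₁ (∈-∖⁻ K C τ∈K∖C))

    ∂∈boundaries-∖ : ∀ {C σ} → σ ∈ ofLength (suc d) (simplices K) → σ ∉ C → incidence σ ∈ boundaries (K ∖ C) d
    ∂∈boundaries-∖ {C} σ∈Kᵈ⁺¹ σ∉C = ∈-map⁺ incidence (∈-ofLength⁺ (suc d) (∈-∖⁺ K C σ∈K σ∉C) |σ|≡d+1)
      where
      σ∈K = proj₁ (∈-ofLength⁻ (suc d) {simplices K} σ∈Kᵈ⁺¹)
      |σ|≡d+1 = proj₂ (∈-ofLength⁻ (suc d) {simplices K} σ∈Kᵈ⁺¹)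

    minimal⇒∂∉B : ∀ {C} → C ⊆ˢ ofLength (suc d) (simplices K) →
      (∀ C′ → C′ ⊂ˢ C → ∀ a b → HomologyDim (K ∖ C′) d a → HomologyDim (K ∖ C) d b → a < b) →
      ∀ σ → σ ∈ C → ¬ Span T₀ (boundaries (K ∖ C) d) (incidence σ)
    minimal⇒∂∉B {C} C⊆ minimal σ σ∈C ∂σ∈B =
      ℕ.<-irrefl refl (minimal C′ C′⊂C r r (HomologyDim-cong same-cycles same-boundaries H) H)
      where
      C′ = filter (λ c → ¬? (c ≟ₛ σ)) C
      C′⊆C : C′ ⊆ˢ C
      C′⊆C c c∈C′ = proj₁ (∈-filter⁻ (λ c → ¬? (c ≟ₛ σ)) {xs = C} c∈C′)
      C′⊂C : C′ ⊂ˢ C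
      C′⊂C = C′⊆C , σ , σ∈C , (λ σ∈C′ → proj₂ (∈-filter⁻ (λ c → ¬? (c ≟ₛ σ)) {xs = C} σ∈C′) refl)
      C′⊆ : C′ ⊆ˢ ofLength (suc d) (simplices K)
      C′⊆ c c∈C′ = C⊆ c (C′⊆C c c∈C′)

      r = proj₁ (homologyDim (K ∖ C) d (∖-unique C))
      H = proj₂ (homologyDim (K ∖ C) d (∖-unique C))

      same-cycles : ∀ y → IsCycle (K ∖ C) d y ⇔ IsCycle (K ∖ C′) d y
      same-cycles y = ⇔-sym (IsCycle-∖ C′⊆ y) ⇔-∘ IsCycle-∖ C⊆ y

      K∖C⊆K∖C′ : (K ∖ C) ⊆ˢ (K ∖ C′)
      K∖C⊆K∖C′ τ τ∈ = ∈-∖⁺ K C′ (proj₁ (∈-∖⁻ K C τ∈)) (λ τ∈C′ → proj₂ (∈-∖⁻ K C τ∈) (C′⊆C τ τ∈C′))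

      B′⊆⟨B⟩ : ∀ g → g ∈ boundaries (K ∖ C′) d → Span T₀ (boundaries (K ∖ C) d) g
      B′⊆⟨B⟩ g g∈ with ∈-map⁻ incidence g∈
      ... | τ , τ∈ , refl with τ ≟ₛ σ
      ...   | yes refl = ∂σ∈B
      ...   | no  τ≢σ  = Span-∈ T₀ (∂∈boundaries-∖ (∈-ofLength⁺ (suc d) τ∈K |τ|≡d+1) τ∉C)
        where
        τ∈K∖C′ = proj₁ (∈-ofLength⁻ (suc d) {K ∖ C′} τ∈)
        |τ|≡d+1 = proj₂ (∈-ofLength⁻ (suc d) {K ∖ C′} τ∈)
        τ∈K = proj₁ (∈-∖⁻ K C′ τ∈K∖C′)
        τ∉C : τ ∉ C
        τ∉C τ∈C = proj₂ (∈-∖⁻ K C′ τ∈K∖C′) (∈-filter⁺ (λ c → ¬? (c ≟ₛ σ)) τ∈C τ≢σ)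

      same-boundaries : ∀ z → IsBoundary (K ∖ C) d z ⇔ IsBoundary (K ∖ C′) d z
      same-boundaries z = ⇔-sym (IsBoundary-∖⇔Span C′⊆ z)
        ⇔-∘ (mk⇔ (Span-mono T₀ (boundaries-mono d K∖C⊆K∖C′)) (Span-trans T₀ B′⊆⟨B⟩)
        ⇔-∘ IsBoundary-∖⇔Span C⊆ z)

proposition7 : ∀ {n} (K : Complex n) (d : ℕ) → HasDimension K d →
    (γ : Chain n) → IsCycle (simplices K) d γ → IsBoundary (simplices K) d γ →
    (C : List (Simplex n)) → IsCut K d γ C →
    (∀ C′ → C′ ⊂ˢ C → ∀ a b → HomologyDim (K ∖ C′) d a → HomologyDim (K ∖ C) d b → a < b) →
    Σ (Chain n) λ p → ∀ σ → σ ∈ ofLength (suc d) (simplices K) →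
      ((δ p σ ≢ 0ℚ → σ ∈ C) × (σ ∈ C → δ p σ ≢ 0ℚ))
proposition7 {n} K d _ _ _ _ C (C⊆Kᵈ⁺¹ , _) minimal = restrict (T₀ K d) p , λ σ σ∈Kᵈ⁺¹ →
  (λ δp≢0 → decidable-stable (σ ∈? C) (λ σ∉C →
     δp≢0 (trans (δ-restrict T₀! p σ) (B⊥p _ (∂∈boundaries-∖ K d σ∈Kᵈ⁺¹ σ∉C))))) ,
  (λ σ∈C → p-separates σ σ∈C ∘ trans (sym (δ-restrict T₀! p σ)))
  where
  open DecMembership (_≟ₛ_ {n}) using (_∈?_)
  T₀! : Unique (T₀ K d)
  T₀! = ofLength-unique d (unique K)
  separating = Coordinates.separating-vector (T₀ K d) (boundaries (K ∖ C) d) C incidence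
                                             (minimal⇒∂∉B K d C⊆Kᵈ⁺¹ minimal)
  p = proj₁ separating
  B⊥p = proj₁ (proj₂ separating)
  p-separates = proj₂ (proj₂ separating)
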